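{- Let $\hat A,\hat B$ be change actions such that the pointwise functional change action $\hat A\Rightarrow_{pt}\hat B$ is well defined. Let $f:A\to B$ be differentiable with derivative $\partial f$, let $a\in A$, $\delta a\in\Delta A$, $\delta f:A\to\Delta B$, and let $\partial[f\oplus_\to\delta f]$ be a derivative of $f\oplus_\to\delta f$. Then both $$\partial\mathrm{Ev}_1((f,a),(\delta f,\delta a))=\partial f(a,\delta a)+_B\delta f(a\oplus_A\delta a),\qquad \partial\mathrm{Ev}_2((f,a),(\delta f,\delta a))=\delta f(a)+_B\partial[f\oplus_\to\delta f](a,\delta a)$$ are derivatives of the evaluation map, i.e. $(f\oplus_\to\delta f)(a\oplus_A\delta a)=f(a)\oplus_B\partial\mathrm{Ev}_i((f,a),(\delta f,\delta a))$ for $i=1,2$.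
   Context: A change action $\hat A=(A,\Delta A,\oplus,+,0)$ is a set $A$, a monoid $(\Delta A,+,0)$ and a monoid action $\oplus:A\times\Delta A\to A$ ($a\oplus 0=a$, $a\oplus(\delta_1+\delta_2)=(a\oplus\delta_1)\oplus\delta_2$). A derivative of $f:A\to B$ is $\partial f:A\times\Delta A\to\Delta B$ with $f(a\oplus_A\delta)=f(a)\oplus_B\partial f(a,\delta)$; $f$ is differentiable if it has one. The pointwise functional change action $\hat A\Rightarrow_{pt}\hat B$ has as base the differentiable functions $A\to B$, as changes the functions $A\to\Delta B$, with $(f\oplus_\to\delta f)(x)=f(x)\oplus_B\delta f(x)$, $(\delta f+_\to\delta g)(x)=\delta f(x)+_B\delta g(x)$, $0_\to(x)=0_B$; it is well defined when $f\oplus_\to\delta f$ is differentiable for every differentiable $f$ and every $\delta f$. -}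

module Defs where

open import Level using (Level; _⊔_; suc)
open import Data.Product using (Σ; _×_; _,_)
open import Relation.Binary.PropositionalEquality using (_≡_)

record ChangeAction (a : Level) : Set (suc a) where
  field
    Base    : Set a
    Δ       : Set a
    _⊕_     : Base → Δ → Base
    _+_     : Δ → Δ → Δ
    𝟘       : Δ
    +-assoc     : ∀ x y z → (x + y) + z ≡ x + (y + z)
    +-identityˡ : ∀ x → 𝟘 + x ≡ x
    +-identityʳ : ∀ x → x + 𝟘 ≡ x
    ⊕-identity  : ∀ x → x ⊕ 𝟘 ≡ x
    ⊕-act       : ∀ x d₁ d₂ → x ⊕ (d₁ + d₂) ≡ (x ⊕ d₁) ⊕ d₂

open ChangeAction

module _ {a b : Level} (A : ChangeAction a) (B : ChangeAction b) where

  IsDerivative : (Base A → Base B) → (Base A → Δ A → Δ B) → Set (a ⊔ b)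
  IsDerivative f ∂f = ∀ x δx → f (_⊕_ A x δx) ≡ _⊕_ B (f x) (∂f x δx)

  Differentiable : (Base A → Base B) → Set (a ⊔ b)
  Differentiable f = Σ (Base A → Δ A → Δ B) (IsDerivative f)

  _⊕→_ : (Base A → Base B) → (Base A → Δ B) → (Base A → Base B)
  (f ⊕→ δf) x = _⊕_ B (f x) (δf x)

  PtWellDefined : Set (a ⊔ b)
  PtWellDefined = ∀ (f : Base A → Base B) → Differentiable f →
                  ∀ (δf : Base A → Δ B) → Differentiable (f ⊕→ δf)

  Ev : (Σ (Base A → Base B) Differentiable) × Base A → Base B
  Ev ((f , _) , x) = f x

-- Both formulas only use that ⊕ on B is a monoid action: either first move f
-- along δx by ∂f and then add δf at the moved point, or first add δf at the
-- base point and then move f ⊕→ δf along δx by its own derivative.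
module Submission where

open import Defs
open import Level using (Level)
open import Data.Product using (_×_; _,_)
open import Relation.Binary.PropositionalEquality using (_≡_; cong; sym; module ≡-Reasoning)

open ChangeAction

module _ {a b : Level} (A : ChangeAction a) (B : ChangeAction b) where

  private
    _⊕A_ = _⊕_ A
    _⊕B_ = _⊕_ B
    _+B_ = _+_ B
    _⊕→'_ = _⊕→_ A B

  ⊕→-at-⊕-via-∂f : ∀ f ∂f → IsDerivative A B f ∂f → ∀ δf x δx →
    (f ⊕→' δf) (x ⊕A δx) ≡ f x ⊕B (∂f x δx +B δf (x ⊕A δx))
  ⊕→-at-⊕-via-∂f f ∂f isD δf x δx = begin
    f (x ⊕A δx) ⊕B δf (x ⊕A δx)           ≡⟨ cong (_⊕B δf (x ⊕A δx)) (isD x δx) ⟩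
    (f x ⊕B ∂f x δx) ⊕B δf (x ⊕A δx)      ≡⟨ sym (⊕-act B (f x) (∂f x δx) (δf (x ⊕A δx))) ⟩
    f x ⊕B (∂f x δx +B δf (x ⊕A δx))      ∎
    where open ≡-Reasoning

  ⊕→-at-⊕-via-∂[⊕→] : ∀ f δf ∂g → IsDerivative A B (f ⊕→' δf) ∂g → ∀ x δx →
    (f ⊕→' δf) (x ⊕A δx) ≡ f x ⊕B (δf x +B ∂g x δx)
  ⊕→-at-⊕-via-∂[⊕→] f δf ∂g isG x δx = begin
    (f ⊕→' δf) (x ⊕A δx)                  ≡⟨ isG x δx ⟩
    (f x ⊕B δf x) ⊕B ∂g x δx              ≡⟨ sym (⊕-act B (f x) (δf x) (∂g x δx)) ⟩
    f x ⊕B (δf x +B ∂g x δx)              ∎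
    where open ≡-Reasoning

mainTheorem14 : {a b : Level} (A : ChangeAction a) (B : ChangeAction b) →
    PtWellDefined A B →
    (f : ChangeAction.Base A → ChangeAction.Base B) →
    (∂f : ChangeAction.Base A → ChangeAction.Δ A → ChangeAction.Δ B) →
    (isD : IsDerivative A B f ∂f) →
    (x : ChangeAction.Base A) (δx : ChangeAction.Δ A) →
    (δf : ChangeAction.Base A → ChangeAction.Δ B) →
    (∂g : ChangeAction.Base A → ChangeAction.Δ A → ChangeAction.Δ B) →
    IsDerivative A B (_⊕→_ A B f δf) ∂g →
    (_⊕→_ A B f δf (ChangeAction._⊕_ A x δx)
       ≡ ChangeAction._⊕_ B (f x) (ChangeAction._+_ B (∂f x δx) (δf (ChangeAction._⊕_ A x δx))))
    ×
    (_⊕→_ A B f δf (ChangeAction._⊕_ A x δx)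
       ≡ ChangeAction._⊕_ B (f x) (ChangeAction._+_ B (δf x) (∂g x δx)))
mainTheorem14 A B _ f ∂f isD x δx δf ∂g isG =
  ⊕→-at-⊕-via-∂f A B f ∂f isD δf x δx , ⊕→-at-⊕-via-∂[⊕→] A B f δf ∂g isG x δx
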